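{- Let $\gamma \geq 2$ and $n \geq 3\gamma$ be integers. Let $\mathcal{B}_{n,\gamma}$ denote the set of all bipartite graphs without isolated vertices that have order $n$, domination number $\gamma$, and exactly one minimum dominating set. Then there exists $G \in \mathcal{B}_{n,\gamma}$ whose number of edges $s(G)$ equals $$m(n,\gamma) = 2 \gamma + 2 \Big\lceil \frac{\gamma}{2} \Big\rceil \Big\lfloor \frac{\gamma}{2} \Big\rfloor + \min\Big\{n-3\gamma,\ 2 \Big\lceil \frac{\gamma}{2} \Big\rceil - \Big\lfloor \frac{\gamma}{2}\Big\rfloor+ 1\Big\}\Big(2\Big\lceil\frac{\gamma}{2}\Big\rceil + 1\Big) + \sum_{i=1}^{\Phi} \Big(\Big(2\Big\lceil\frac{\gamma}{2}\Big\rceil+1\Big) + \Big\lceil\frac{i}{2}\Big\rceil\Big),$$ where $\Phi = \Phi(n,\gamma) = \max\big(0,\ n-3\gamma - 2\lceil\frac{\gamma}{2}\rceil - \lfloor\frac{\gamma}{2}\rfloor + 1\big)$ (an empty sum is $0$).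
   Context: All graphs are finite and simple. A dominating set of a graph $G=(V,E)$ is a set $D\subseteq V$ such that every vertex of $V\setminus D$ is adjacent to some vertex of $D$; the domination number $\gamma(G)$ is the minimum size of a dominating set, and a minimum dominating set is a dominating set of size $\gamma(G)$. The size $s(G)$ is the number of edges of $G$. -}

module Defs where

open import Data.Nat using (ℕ; zero; suc; _+_; _*_; _∸_; _⊓_; _≤_; _<ᵇ_; ⌈_/2⌉; ⌊_/2⌋)
open import Data.Bool using (Bool; true; false; _∧_; if_then_else_)
open import Data.Fin using (Fin; toℕ)
open import Data.Fin.Subset using (Subset; _∈_; _∉_; ∣_∣)
open import Data.List using (List; map; allFin)
open import Data.Nat.ListAction using (sum)
open import Data.Product using (Σ; ∃; ∃-syntax; _×_; _,_)
open import Data.Sum using (_⊎_)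
open import Relation.Binary.PropositionalEquality using (_≡_; _≢_)

record Graph (n : ℕ) : Set where
  field
    adj   : Fin n → Fin n → Bool
    sym   : ∀ u v → adj u v ≡ adj v u
    irrefl : ∀ v → adj v v ≡ false
open Graph public

size : ∀ {n} → Graph n → ℕ
size {n} G = sum (map (λ i → sum (map (λ j → if (toℕ i <ᵇ toℕ j) ∧ adj G i j then 1 else 0) (allFin n))) (allFin n))

IsDominating : ∀ {n} → Graph n → Subset n → Set
IsDominating {n} G D = ∀ (v : Fin n) → v ∉ D → ∃[ u ] (u ∈ D × adj G u v ≡ true)

DominationNumber : ∀ {n} → Graph n → ℕ → Set
DominationNumber {n} G k =
  (∃[ D ] (IsDominating G D × ∣ D ∣ ≡ k)) × (∀ (D : Subset n) → IsDominating G D → k ≤ ∣ D ∣)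

IsMinDominating : ∀ {n} → Graph n → Subset n → Set
IsMinDominating {n} G D = IsDominating G D × (∀ (D' : Subset n) → IsDominating G D' → ∣ D ∣ ≤ ∣ D' ∣)

UniqueMinDominating : ∀ {n} → Graph n → Set
UniqueMinDominating {n} G = ∃[ D ] (IsMinDominating G D × (∀ (D' : Subset n) → IsMinDominating G D' → D' ≡ D))

IsBipartite : ∀ {n} → Graph n → Set
IsBipartite {n} G = Σ (Fin n → Bool) λ c → (∀ (u v : Fin n) → adj G u v ≡ true → c u ≢ c v)

NoIsolated : ∀ {n} → Graph n → Set
NoIsolated {n} G = ∀ (v : Fin n) → ∃[ u ] (adj G u v ≡ true)

InB : (n γ : ℕ) → Graph n → Set
InB n γ G = IsBipartite G × NoIsolated G × DominationNumber G γ × UniqueMinDominating G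

sumFrom1 : ℕ → (ℕ → ℕ) → ℕ
sumFrom1 zero f = 0
sumFrom1 (suc k) f = sumFrom1 k f + f (suc k)

-- Φ(n,γ) = max(0, n - 3γ - 2⌈γ/2⌉ - ⌊γ/2⌋ + 1)  (truncated subtraction realises max(0,·))
Φ : ℕ → ℕ → ℕ
Φ n γ = (n + 1) ∸ (3 * γ + 2 * ⌈ γ /2⌉ + ⌊ γ /2⌋)

-- m(n,γ)  (for n ≥ 3γ all subtractions below are exact)
m : ℕ → ℕ → ℕ
m n γ = 2 * γ + 2 * ⌈ γ /2⌉ * ⌊ γ /2⌋
      + ((n ∸ 3 * γ) ⊓ ((2 * ⌈ γ /2⌉ + 1) ∸ ⌊ γ /2⌋)) * (2 * ⌈ γ /2⌉ + 1)
      + sumFrom1 (Φ n γ) (λ i → (2 * ⌈ γ /2⌉ + 1) + ⌈ i /2⌉)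

{-# OPTIONS --safe #-}
-- Take the bipartite graph with sides  hubs ⊎ leaves ⊎ centres  and  spokes ⊎ supports
-- (H, A, B and P, A vertices): leaf i hangs at support i, spoke p at centre (p mod B), hub q is
-- joined to support (q mod A), and the first r pairs of the H × P grid of (hub, spoke) pairs are
-- joined as well. The closed neighbourhoods of the leaves and centres are pairwise disjoint, so
-- every dominating set has at least A + B vertices, and one with exactly A + B vertices meets each
-- of these neighbourhoods once and contains nothing else. As every centre has two spokes, and
-- hub i (i < A) sees only support i and spokes, such a set must consist of the centres and the
-- supports. The graph has H + P + A + r edges, so every size in an interval of length H P occurs;
-- for suitable H and P the order is n, A + B = γ, and m(n, γ) lies in that interval.
module Submission where

open import Defs hiding (sym)
open import Data.Bool using (Bool; true; false; _∧_; if_then_else_)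
open import Data.Bool.Properties using (∧-zeroʳ)
open import Data.Fin using (Fin; zero; suc; toℕ; _↑ˡ_; _↑ʳ_; splitAt; join; inject≤; fromℕ<)
open import Data.Fin.Properties
  using (_≟_; any?; toℕ-injective; toℕ<n; toℕ-fromℕ<; toℕ-inject≤; toℕ-↑ˡ; toℕ-↑ʳ;
         splitAt-↑ˡ; splitAt-↑ʳ; splitAt-join; join-splitAt)
import Data.Fin.Properties as Finₚ
open import Data.Fin.Subset using (Subset; _∈_; ∣_∣; _-_)
open import Data.Fin.Subset.Properties using (_∈?_; x∈p∧x≢y⇒x∈p-y; x∈p⇒∣p-x∣<∣p∣; ⊆-antisym)
open import Data.List using (allFin; map; tabulate)
open import Data.List.Properties using (map-tabulate)
open import Data.Nat
  using (ℕ; zero; suc; _+_; _*_; _∸_; _⊓_; _≤_; _<_; _<ᵇ_; z≤n; s≤s; s<s; s≤s⁻¹;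
         NonZero; >-nonZero; >-nonZero⁻¹; ⌊_/2⌋; ⌈_/2⌉)
open import Data.Nat.DivMod using (_mod_; m<n⇒m%n≡m; [m+n]%n≡m%n)
open import Data.Nat.ListAction using (sum)
open import Data.Nat.Properties
  using (+-0-commutativeMonoid; +-assoc; +-comm; +-identityʳ; +-suc; *-comm; ⊓-comm; ⊓-zeroʳ;
         ≤-refl; ≤-reflexive; ≤-trans; ≤-total; <⇒≤; <⇒≢; <-irrefl; m≤n⇒m<n∨m≡n;
         m≤m+n; m≤n+m; m<m+n; +-mono-≤; +-monoˡ-≤; +-monoʳ-≤; +-monoˡ-<; ∸-monoʳ-≤;
         ∸-+-assoc; m≤n+m∸n; m≤n+o⇒m∸n≤o; m+[n∸m]≡n; [m+n]∸[m+o]≡n∸o; m≤n⇒m∸n≡0;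
         m≤n⇒m⊓n≡m; m≥n⇒m⊓n≡n; m⊓n+n∸m≡n; ⌊n/2⌋-mono; ⌊n/2⌋≤⌈n/2⌉; ⌊n/2⌋+⌈n/2⌉≡n;
         module ≤-Reasoning)
open import Data.Nat.Tactic.RingSolver using (solve-∀)
open import Algebra.Properties.CommutativeMonoid.Sum +-0-commutativeMonoid
  using (sum-syntax; sum-cong-≗; ∑-distrib-+; ∑-comm)
open import Data.Product using (Σ; ∃-syntax; _×_; _,_; proj₁; proj₂)
open import Data.Sum using (_⊎_; inj₁; inj₂; map₁; map₂) renaming (map to ⊎-map)
import Data.Vec as Vec
import Data.Vec.Properties as Vecₚ
open import Data.Vec.Functional using (_∷_)
open import Function using (_∘_)
open import Function.Definitions using (Injective)
open import Relation.Binary.PropositionalEquality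
open import Relation.Nullary using (¬_; yes; no; does; contradiction)
open import Relation.Nullary.Decidable using (dec-true)

≟-sound : ∀ {n} {i j : Fin n} → does (i ≟ j) ≡ true → i ≡ j
≟-sound {i = i} {j} e with i ≟ j
... | yes i≡j = i≡j

≟-complete : ∀ {n} {i j : Fin n} → i ≡ j → does (i ≟ j) ≡ true
≟-complete {i = i} {j} = dec-true (i ≟ j)

≟-refl : ∀ {n} (i : Fin n) → does (i ≟ i) ≡ true
≟-refl i = ≟-complete {i = i} refl

toℕ-mod : ∀ {n} .{{_ : NonZero n}} (i : Fin n) → toℕ i mod n ≡ i
toℕ-mod i = toℕ-injective (trans (toℕ-fromℕ< _) (m<n⇒m%n≡m (toℕ<n i)))

toℕ+n-mod : ∀ {n} .{{_ : NonZero n}} (i : Fin n) → (toℕ i + n) mod n ≡ i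
toℕ+n-mod {n} i =
  toℕ-injective (trans (toℕ-fromℕ< _) (trans ([m+n]%n≡m%n (toℕ i) n) (m<n⇒m%n≡m (toℕ<n i))))

-- Finite sums

⟦_⟧ : Bool → ℕ
⟦ b ⟧ = if b then 1 else 0

sum-tabulate : ∀ {n} (f : Fin n → ℕ) → sum (tabulate f) ≡ ∑[ i < n ] f i
sum-tabulate {zero}  f = refl
sum-tabulate {suc n} f = cong (f zero +_) (sum-tabulate (f ∘ suc))

sum-map-allFin : ∀ {n} (f : Fin n → ℕ) → sum (map f (allFin n)) ≡ ∑[ i < n ] f i
sum-map-allFin f = trans (cong sum (map-tabulate (λ i → i) f)) (sum-tabulate f)

∑-zero : ∀ n → ∑[ i < n ] 0 ≡ 0
∑-zero zero    = refl
∑-zero (suc n) = ∑-zero n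

∑-one : ∀ n → ∑[ i < n ] 1 ≡ n
∑-one zero    = refl
∑-one (suc n) = cong suc (∑-one n)

∑-↑ : ∀ m {n} (f : Fin (m + n) → ℕ) →
      ∑[ i < m + n ] f i ≡ ∑[ i < m ] f (i ↑ˡ n) + ∑[ j < n ] f (m ↑ʳ j)
∑-↑ zero    f = refl
∑-↑ (suc m) f = trans (cong (f zero +_) (∑-↑ m (f ∘ suc))) (sym (+-assoc (f zero) _ _))

∑-splitAt : ∀ m {n} (f : Fin m ⊎ Fin n → ℕ) →
            ∑[ x < m + n ] f (splitAt m x) ≡ ∑[ i < m ] f (inj₁ i) + ∑[ j < n ] f (inj₂ j)
∑-splitAt zero    f = refl
∑-splitAt (suc m) f =
  trans (cong (f (inj₁ zero) +_) (∑-splitAt m (f ∘ map₁ suc))) (sym (+-assoc (f (inj₁ zero)) _ _))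

∑-singleton : ∀ {n} (i : Fin n) → ∑[ j < n ] ⟦ does (i ≟ j) ⟧ ≡ 1
∑-singleton {suc n} zero    = cong suc (∑-zero n)
∑-singleton {suc n} (suc i) = ∑-singleton i

∑-below : ∀ n c r → ∑[ i < n ] ⟦ c + toℕ i <ᵇ r ⟧ ≡ (r ∸ c) ⊓ n
∑-below zero    c r = sym (⊓-zeroʳ (r ∸ c))
∑-below (suc n) c r = begin
  ⟦ c + 0 <ᵇ r ⟧ + ∑[ i < n ] ⟦ c + suc (toℕ i) <ᵇ r ⟧
    ≡⟨ cong₂ _+_ (cong (λ x → ⟦ x <ᵇ r ⟧) (+-identityʳ c))
                 (sum-cong-≗ {n} (λ i → cong (λ x → ⟦ x <ᵇ r ⟧) (+-suc c (toℕ i)))) ⟩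
  ⟦ c <ᵇ r ⟧ + ∑[ i < n ] ⟦ suc c + toℕ i <ᵇ r ⟧
    ≡⟨ cong (⟦ c <ᵇ r ⟧ +_) (∑-below n (suc c) r) ⟩
  ⟦ c <ᵇ r ⟧ + (r ∸ suc c) ⊓ n
    ≡⟨ step c r ⟩
  (r ∸ c) ⊓ suc n ∎
  where
  open ≡-Reasoning
  step : ∀ c r → ⟦ c <ᵇ r ⟧ + (r ∸ suc c) ⊓ n ≡ (r ∸ c) ⊓ suc n
  step zero    zero    = refl
  step zero    (suc r) = refl
  step (suc c) zero    = refl
  step (suc c) (suc r) = step c r

⊓-+-∸ : ∀ x p q → x ⊓ p + (x ∸ p) ⊓ q ≡ x ⊓ (p + q)
⊓-+-∸ zero    zero    q = refl
⊓-+-∸ zero    (suc p) q = refl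
⊓-+-∸ (suc x) zero    q = refl
⊓-+-∸ (suc x) (suc p) q = cong suc (⊓-+-∸ x p q)

∑-grid : ∀ H P r → ∑[ q < H ] ∑[ p < P ] ⟦ toℕ q * P + toℕ p <ᵇ r ⟧ ≡ r ⊓ (H * P)
∑-grid H P r = trans (sum-cong-≗ {H} (λ q → ∑-below P (toℕ q * P) r)) (rows H r)
  where
  rows : ∀ H r → ∑[ q < H ] ((r ∸ toℕ q * P) ⊓ P) ≡ r ⊓ (H * P)
  rows zero    r = sym (⊓-zeroʳ r)
  rows (suc H) r = begin
    r ⊓ P + ∑[ q < H ] ((r ∸ (P + toℕ q * P)) ⊓ P)
      ≡⟨ cong (r ⊓ P +_) (sum-cong-≗ {H} (λ q → cong (_⊓ P) (sym (∸-+-assoc r P (toℕ q * P))))) ⟩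
    r ⊓ P + ∑[ q < H ] (((r ∸ P) ∸ toℕ q * P) ⊓ P)
      ≡⟨ cong (r ⊓ P +_) (rows H (r ∸ P)) ⟩
    r ⊓ P + (r ∸ P) ⊓ (H * P)
      ≡⟨ ⊓-+-∸ r P (H * P) ⟩
    r ⊓ (P + H * P) ∎
    where open ≡-Reasoning

∣tabulate∣ : ∀ {n} (p : Fin n → Bool) → ∣ Vec.tabulate p ∣ ≡ ∑[ i < n ] ⟦ p i ⟧
∣tabulate∣ {zero}  p = refl
∣tabulate∣ {suc n} p with p zero
... | true  = cong suc (∣tabulate∣ (p ∘ suc))
... | false = ∣tabulate∣ (p ∘ suc)

∈-tabulate⁺ : ∀ {n} {p : Fin n → Bool} {i} → p i ≡ true → i ∈ Vec.tabulate p
∈-tabulate⁺ {p = p} {i} e = Vecₚ.lookup⇒[]= i (Vec.tabulate p) (trans (Vecₚ.lookup∘tabulate p i) e)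

∈-tabulate⁻ : ∀ {n} {p : Fin n → Bool} {i} → i ∈ Vec.tabulate p → p i ≡ true
∈-tabulate⁻ {p = p} {i} i∈ = trans (sym (Vecₚ.lookup∘tabulate p i)) (Vecₚ.[]=⇒lookup i∈)

-- Bipartite graphs given by a biadjacency relation

<ᵇ-true : ∀ {m n} → m < n → (m <ᵇ n) ≡ true
<ᵇ-true {zero}  {suc n} _         = refl
<ᵇ-true {suc m} {suc n} (s<s m<n) = <ᵇ-true m<n

<ᵇ-false : ∀ {m n} → n ≤ m → (m <ᵇ n) ≡ false
<ᵇ-false {m}     {zero}  _         = refl
<ᵇ-false {suc m} {suc n} (s≤s n≤m) = <ᵇ-false n≤m

toℕ-↑ˡ<↑ʳ : ∀ {m n} (i : Fin m) (j : Fin n) → toℕ (i ↑ˡ n) < toℕ (m ↑ʳ j)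
toℕ-↑ˡ<↑ʳ {m} {n} i j rewrite toℕ-↑ˡ i n | toℕ-↑ʳ m j = ≤-trans (toℕ<n i) (m≤m+n m (toℕ j))

module _ {L R : Set} where

  biadj : (L → R → Bool) → L ⊎ R → L ⊎ R → Bool
  biadj E (inj₁ l) (inj₂ r) = E l r
  biadj E (inj₂ r) (inj₁ l) = E l r
  biadj E _        _        = false

  onLeft : L ⊎ R → Bool
  onLeft (inj₁ _) = true
  onLeft (inj₂ _) = false

  biadj-sym : ∀ E x y → biadj E x y ≡ biadj E y x
  biadj-sym E (inj₁ l) (inj₁ l′) = refl
  biadj-sym E (inj₁ l) (inj₂ r)  = refl
  biadj-sym E (inj₂ r) (inj₁ l)  = refl
  biadj-sym E (inj₂ r) (inj₂ r′) = refl

  biadj-irrefl : ∀ E x → biadj E x x ≡ false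
  biadj-irrefl E (inj₁ l) = refl
  biadj-irrefl E (inj₂ r) = refl

  biadj-proper : ∀ E x y → biadj E x y ≡ true → onLeft x ≢ onLeft y
  biadj-proper E (inj₁ l) (inj₂ r) _ ()
  biadj-proper E (inj₂ r) (inj₁ l) _ ()

biadj-map : ∀ {L R L′ R′ : Set} (E : L → R → Bool) (f : L′ → L) (g : R′ → R) x y →
            biadj (λ l r → E (f l) (g r)) x y ≡ biadj E (⊎-map f g x) (⊎-map f g y)
biadj-map E f g (inj₁ l) (inj₁ l′) = refl
biadj-map E f g (inj₁ l) (inj₂ r)  = refl
biadj-map E f g (inj₂ r) (inj₁ l)  = refl
biadj-map E f g (inj₂ r) (inj₂ r′) = refl

bipartiteGraph : ∀ {ℓ ρ} → (Fin ℓ → Fin ρ → Bool) → Graph (ℓ + ρ)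
bipartiteGraph {ℓ} E = record
  { adj    = λ u v → biadj E (splitAt ℓ u) (splitAt ℓ v)
  ; sym    = λ u v → biadj-sym E (splitAt ℓ u) (splitAt ℓ v)
  ; irrefl = λ v → biadj-irrefl E (splitAt ℓ v)
  }

bipartiteGraph-isBipartite : ∀ {ℓ ρ} (E : Fin ℓ → Fin ρ → Bool) → IsBipartite (bipartiteGraph E)
bipartiteGraph-isBipartite {ℓ} E =
  onLeft ∘ splitAt ℓ , λ u v → biadj-proper E (splitAt ℓ u) (splitAt ℓ v)

size-bipartiteGraph : ∀ {ℓ ρ} (E : Fin ℓ → Fin ρ → Bool) →
                      size (bipartiteGraph E) ≡ ∑[ l < ℓ ] ∑[ r < ρ ] ⟦ E l r ⟧
size-bipartiteGraph {ℓ} {ρ} E = begin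
  size (bipartiteGraph E)
    ≡⟨ trans (sum-map-allFin (λ u → sum (map (cell u) (allFin (ℓ + ρ)))))
             (sum-cong-≗ {ℓ + ρ} (λ u → sum-map-allFin (cell u))) ⟩
  ∑[ u < ℓ + ρ ] ∑[ v < ℓ + ρ ] cell u v
    ≡⟨ ∑-↑ ℓ (λ u → ∑[ v < ℓ + ρ ] cell u v) ⟩
  ∑[ l < ℓ ] ∑[ v < ℓ + ρ ] cell (l ↑ˡ ρ) v + ∑[ r < ρ ] ∑[ v < ℓ + ρ ] cell (ℓ ↑ʳ r) v
    ≡⟨ cong₂ _+_ (sum-cong-≗ {ℓ} left-row) (trans (sum-cong-≗ {ρ} right-row) (∑-zero ρ)) ⟩
  ∑[ l < ℓ ] ∑[ r < ρ ] ⟦ E l r ⟧ + 0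
    ≡⟨ +-identityʳ _ ⟩
  ∑[ l < ℓ ] ∑[ r < ρ ] ⟦ E l r ⟧ ∎
  where
  open ≡-Reasoning
  cell : Fin (ℓ + ρ) → Fin (ℓ + ρ) → ℕ
  cell u v = ⟦ (toℕ u <ᵇ toℕ v) ∧ adj (bipartiteGraph E) u v ⟧

  left-row : ∀ l → ∑[ v < ℓ + ρ ] cell (l ↑ˡ ρ) v ≡ ∑[ r < ρ ] ⟦ E l r ⟧
  left-row l = begin
    ∑[ v < ℓ + ρ ] cell (l ↑ˡ ρ) v
      ≡⟨ ∑-↑ ℓ (cell (l ↑ˡ ρ)) ⟩
    ∑[ l′ < ℓ ] cell (l ↑ˡ ρ) (l′ ↑ˡ ρ) + ∑[ r < ρ ] cell (l ↑ˡ ρ) (ℓ ↑ʳ r)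
      ≡⟨ cong₂ _+_ (trans (sum-cong-≗ {ℓ} same-side) (∑-zero ℓ)) (sum-cong-≗ {ρ} across) ⟩
    ∑[ r < ρ ] ⟦ E l r ⟧ ∎
    where
    same-side : ∀ l′ → cell (l ↑ˡ ρ) (l′ ↑ˡ ρ) ≡ 0
    same-side l′ rewrite splitAt-↑ˡ ℓ l ρ | splitAt-↑ˡ ℓ l′ ρ = cong ⟦_⟧ (∧-zeroʳ _)
    across : ∀ r → cell (l ↑ˡ ρ) (ℓ ↑ʳ r) ≡ ⟦ E l r ⟧
    across r rewrite splitAt-↑ˡ ℓ l ρ | splitAt-↑ʳ ℓ ρ r | <ᵇ-true (toℕ-↑ˡ<↑ʳ l r) = refl

  right-row : ∀ r → ∑[ v < ℓ + ρ ] cell (ℓ ↑ʳ r) v ≡ 0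
  right-row r = begin
    ∑[ v < ℓ + ρ ] cell (ℓ ↑ʳ r) v
      ≡⟨ ∑-↑ ℓ (cell (ℓ ↑ʳ r)) ⟩
    ∑[ l < ℓ ] cell (ℓ ↑ʳ r) (l ↑ˡ ρ) + ∑[ r′ < ρ ] cell (ℓ ↑ʳ r) (ℓ ↑ʳ r′)
      ≡⟨ cong₂ _+_ (trans (sum-cong-≗ {ℓ} backwards) (∑-zero ℓ))
                   (trans (sum-cong-≗ {ρ} same-side) (∑-zero ρ)) ⟩
    0 ∎
    where
    backwards : ∀ l → cell (ℓ ↑ʳ r) (l ↑ˡ ρ) ≡ 0
    backwards l rewrite splitAt-↑ˡ ℓ l ρ | splitAt-↑ʳ ℓ ρ r | <ᵇ-false (<⇒≤ (toℕ-↑ˡ<↑ʳ l r)) = refl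
    same-side : ∀ r′ → cell (ℓ ↑ʳ r) (ℓ ↑ʳ r′) ≡ 0
    same-side r′ rewrite splitAt-↑ʳ ℓ ρ r | splitAt-↑ʳ ℓ ρ r′ = cong ⟦_⟧ (∧-zeroʳ _)

-- Dominating sets and packings

Dominates : ∀ {n} → Graph n → Fin n → Fin n → Set
Dominates G u v = u ≡ v ⊎ adj G u v ≡ true

dominator : ∀ {n} {G : Graph n} {D : Subset n} → IsDominating G D →
            ∀ v → ∃[ u ] (u ∈ D × Dominates G u v)
dominator {D = D} dom v with v ∈? D
... | yes v∈D = v , v∈D , inj₁ refl
... | no  v∉D with dom v v∉D
...   | u , u∈D , u~v = u , u∈D , inj₂ u~v

injection⇒≤∣∣ : ∀ {k n} {D : Subset n} (f : Fin k → Fin n) → Injective _≡_ _≡_ f →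
                (∀ c → f c ∈ D) → k ≤ ∣ D ∣
injection⇒≤∣∣ {zero}          f f-inj f∈D = z≤n
injection⇒≤∣∣ {suc k} {D = D} f f-inj f∈D =
  ≤-trans (s≤s (injection⇒≤∣∣ (f ∘ suc) (λ e → Finₚ.suc-injective (f-inj e)) f∘suc∈D-f₀))
          (x∈p⇒∣p-x∣<∣p∣ (f∈D zero))
  where
  f∘suc∈D-f₀ : ∀ c → f (suc c) ∈ D - f zero
  f∘suc∈D-f₀ c = x∈p∧x≢y⇒x∈p-y (f∈D (suc c)) (λ e → Finₚ.0≢1+n (f-inj (sym e)))

injection-onto : ∀ {k n} {D : Subset n} (f : Fin k → Fin n) → Injective _≡_ _≡_ f →
                 (∀ c → f c ∈ D) → ∣ D ∣ ≤ k → ∀ {v} → v ∈ D → ∃[ c ] f c ≡ v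
injection-onto {D = D} f f-inj f∈D ∣D∣≤k {v} v∈D with any? (λ c → f c ≟ v)
... | yes found = found
... | no  v∉f   =
  contradiction (≤-trans (injection⇒≤∣∣ (v ∷ f) extended-inj extended∈D) ∣D∣≤k) (<-irrefl refl)
  where
  extended∈D : ∀ c → (v ∷ f) c ∈ D
  extended∈D zero    = v∈D
  extended∈D (suc c) = f∈D c
  extended-inj : Injective _≡_ _≡_ (v ∷ f)
  extended-inj {zero}  {zero}   _ = refl
  extended-inj {zero}  {suc c′} e = contradiction (c′ , sym e) v∉f
  extended-inj {suc c} {zero}   e = contradiction (c , e) v∉f
  extended-inj {suc c} {suc c′} e = cong suc (f-inj e)

IsPacking : ∀ {n k} → Graph n → (Fin k → Fin n) → Set
IsPacking G w = ∀ {c c′ u} → Dominates G u (w c) → Dominates G u (w c′) → c ≡ c′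

module Packing {n k} {G : Graph n} {w : Fin k → Fin n} (packing : IsPacking G w)
               {D : Subset n} (dom : IsDominating G D) where

  private
    picked : ∀ c → ∃[ u ] (u ∈ D × Dominates G u (w c))
    picked c = dominator {G = G} dom (w c)

    pick : Fin k → Fin n
    pick c = proj₁ (picked c)

    pick∈D : ∀ c → pick c ∈ D
    pick∈D c = proj₁ (proj₂ (picked c))

    pick-dominates : ∀ c → Dominates G (pick c) (w c)
    pick-dominates c = proj₂ (proj₂ (picked c))

    pick-injective : Injective _≡_ _≡_ pick
    pick-injective {c} {c′} e =
      packing (pick-dominates c) (subst (λ u → Dominates G u (w c′)) (sym e) (pick-dominates c′))

  ≤∣D∣ : k ≤ ∣ D ∣
  ≤∣D∣ = injection⇒≤∣∣ pick pick-injective pick∈D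

  module Tight (∣D∣≤k : ∣ D ∣ ≤ k) where

    private
      ≡pick : ∀ {u} → u ∈ D → ∃[ c ] pick c ≡ u
      ≡pick = injection-onto pick pick-injective pick∈D ∣D∣≤k

    covered : ∀ {u} → u ∈ D → ∃[ c ] Dominates G u (w c)
    covered u∈D with ≡pick u∈D
    ... | c , refl = c , pick-dominates c

    unique : ∀ {c u v} → u ∈ D → v ∈ D → Dominates G u (w c) → Dominates G v (w c) → u ≡ v
    unique u∈D v∈D u↝c v↝c with ≡pick u∈D | ≡pick v∈D
    ... | cᵤ , refl | cᵥ , refl
      rewrite packing (pick-dominates cᵤ) u↝c | packing (pick-dominates cᵥ) v↝c = refl

uniqueMinimum : ∀ {n k} {G : Graph n} {D₀ : Subset n} → IsDominating G D₀ → ∣ D₀ ∣ ≡ k →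
                (∀ D → IsDominating G D → k ≤ ∣ D ∣) →
                (∀ D → IsDominating G D → ∣ D ∣ ≤ k → D ≡ D₀) →
                DominationNumber G k × UniqueMinDominating G
uniqueMinimum {D₀ = D₀} dom₀ ∣D₀∣≡k lower unique =
  ((D₀ , dom₀ , ∣D₀∣≡k) , lower) ,
  (D₀ , (dom₀ , λ D dom → subst (_≤ ∣ D ∣) (sym ∣D₀∣≡k) (lower D dom)) ,
   λ D (dom , minimal) → unique D dom (subst (∣ D ∣ ≤_) ∣D₀∣≡k (minimal D₀ dom₀)))

-- The construction

pattern hub q     = inj₁ q
pattern leaf i    = inj₂ (inj₁ i)
pattern centre j  = inj₂ (inj₂ j)
pattern spoke p   = inj₁ p
pattern support i = inj₂ i

⊎-map-inverse : ∀ {X X′ Y Y′ : Set} {f : X → X′} {f′ : X′ → X} {g : Y → Y′} {g′ : Y′ → Y} →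
                (∀ x → f′ (f x) ≡ x) → (∀ y → g′ (g y) ≡ y) → ∀ z → ⊎-map f′ g′ (⊎-map f g z) ≡ z
⊎-map-inverse f′∘f g′∘g (inj₁ x) = cong inj₁ (f′∘f x)
⊎-map-inverse f′∘f g′∘g (inj₂ y) = cong inj₂ (g′∘g y)

module Construction (A B H P r : ℕ) .{{_ : NonZero A}} .{{_ : NonZero B}}
                    (A≤H : A ≤ H) (2B≤P : 2 * B ≤ P) where

  Left Right Vertex : Set
  Left   = Fin H ⊎ Fin A ⊎ Fin B
  Right  = Fin P ⊎ Fin A
  Vertex = Left ⊎ Right

  ℓ ρ N : ℕ
  ℓ = H + (A + B)
  ρ = P + A
  N = ℓ + ρ

  left : Fin ℓ → Left
  left = map₂ (splitAt A) ∘ splitAt H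

  right : Fin ρ → Right
  right = splitAt P

  leftIndex : Left → Fin ℓ
  leftIndex = join H (A + B) ∘ map₂ (join A B)

  rightIndex : Right → Fin ρ
  rightIndex = join P A

  vertex : Fin N → Vertex
  vertex = ⊎-map left right ∘ splitAt ℓ

  index : Vertex → Fin N
  index = join ℓ ρ ∘ ⊎-map leftIndex rightIndex

  vertex-index : ∀ x → vertex (index x) ≡ x
  vertex-index x = trans (cong (⊎-map left right) (splitAt-join ℓ ρ (⊎-map leftIndex rightIndex x)))
                         (⊎-map-inverse left-leftIndex (splitAt-join P A) x)
    where
    left-leftIndex : ∀ a → left (leftIndex a) ≡ a
    left-leftIndex a = trans (cong (map₂ (splitAt A)) (splitAt-join H (A + B) (map₂ (join A B) a)))
                             (⊎-map-inverse (λ _ → refl) (splitAt-join A B) a)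

  index-vertex : ∀ u → index (vertex u) ≡ u
  index-vertex u = trans (cong (join ℓ ρ) (⊎-map-inverse leftIndex-left (join-splitAt P A) (splitAt ℓ u)))
                         (join-splitAt ℓ ρ u)
    where
    leftIndex-left : ∀ l → leftIndex (left l) ≡ l
    leftIndex-left l =
      trans (cong (join H (A + B)) (⊎-map-inverse (λ _ → refl) (join-splitAt A B) (splitAt H l)))
            (join-splitAt H (A + B) l)

  index-injective : ∀ {x y} → index x ≡ index y → x ≡ y
  index-injective {x} {y} e = trans (sym (vertex-index x)) (trans (cong vertex e) (vertex-index y))

  ∑-left : ∀ (f : Left → ℕ) →
           ∑[ l < ℓ ] f (left l) ≡ ∑[ q < H ] f (hub q) + (∑[ i < A ] f (leaf i) + ∑[ j < B ] f (centre j))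
  ∑-left f = trans (∑-splitAt H (f ∘ map₂ (splitAt A)))
                   (cong (∑[ q < H ] f (hub q) +_) (∑-splitAt A (f ∘ inj₂)))

  attach : Fin H → Fin A
  attach q = toℕ q mod A

  owner : Fin P → Fin B
  owner p = toℕ p mod B

  Link : Left → Right → Bool
  Link (hub q)    (spoke p)    = toℕ q * P + toℕ p <ᵇ r
  Link (hub q)    (support i)  = does (attach q ≟ i)
  Link (leaf i)   (spoke p)    = false
  Link (leaf i)   (support i′) = does (i ≟ i′)
  Link (centre j) (spoke p)    = does (owner p ≟ j)
  Link (centre j) (support i)  = false

  G : Graph N
  G = bipartiteGraph (λ l x → Link (left l) (right x))

  adj-index : ∀ x u → adj G (index x) u ≡ biadj Link x (vertex u)
  adj-index x u = trans (biadj-map Link left right (splitAt ℓ (index x)) (splitAt ℓ u))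
                        (cong (λ y → biadj Link y (vertex u)) (vertex-index x))

  guard : Fin A → Fin H
  guard i = inject≤ i A≤H

  attach-guard : ∀ i → attach (guard i) ≡ i
  attach-guard i = trans (cong (_mod A) (toℕ-inject≤ i A≤H)) (toℕ-mod i)

  B+B≤P : B + B ≤ P
  B+B≤P = subst (λ x → B + x ≤ P) (+-identityʳ B) 2B≤P

  twin₀ twin₁ : Fin B → Fin P
  twin₀ j = inject≤ j (≤-trans (m≤m+n B B) B+B≤P)
  twin₁ j = fromℕ< (≤-trans (+-monoˡ-< B (toℕ<n j)) B+B≤P)

  owner-twin₀ : ∀ j → owner (twin₀ j) ≡ j
  owner-twin₀ j = trans (cong (_mod B) (toℕ-inject≤ j _)) (toℕ-mod j)

  owner-twin₁ : ∀ j → owner (twin₁ j) ≡ j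
  owner-twin₁ j = trans (cong (_mod B) (toℕ-fromℕ< _)) (toℕ+n-mod j)

  twin₀≢twin₁ : ∀ j → twin₀ j ≢ twin₁ j
  twin₀≢twin₁ j e = <⇒≢ (m<m+n (toℕ j) (>-nonZero⁻¹ B))
                        (trans (sym (toℕ-inject≤ j _)) (trans (cong toℕ e) (toℕ-fromℕ< _)))

  sibling : ∀ p → ∃[ s ] (s ≢ p × owner s ≡ owner p)
  sibling p with p ≟ twin₀ (owner p)
  ... | yes p≡t₀ = twin₁ (owner p) , (λ e → twin₀≢twin₁ (owner p) (trans (sym p≡t₀) (sym e))) ,
                   owner-twin₁ (owner p)
  ... | no  p≢t₀ = twin₀ (owner p) , (λ e → p≢t₀ (sym e)) , owner-twin₀ (owner p)

  degree : Left → ℕ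
  degree a = ∑[ p < P ] ⟦ Link a (spoke p) ⟧ + ∑[ i < A ] ⟦ Link a (support i) ⟧

  size-G : r ≤ H * P → size G ≡ H + P + A + r
  size-G r≤HP = begin
    size G
      ≡⟨ size-bipartiteGraph (λ l x → Link (left l) (right x)) ⟩
    ∑[ l < ℓ ] ∑[ x < ρ ] ⟦ Link (left l) (right x) ⟧
      ≡⟨ sum-cong-≗ {ℓ} (λ l → ∑-splitAt P (λ y → ⟦ Link (left l) y ⟧)) ⟩
    ∑[ l < ℓ ] degree (left l)
      ≡⟨ ∑-left degree ⟩
    ∑[ q < H ] degree (hub q) + (∑[ i < A ] degree (leaf i) + ∑[ j < B ] degree (centre j))
      ≡⟨ cong₂ _+_ hubs (cong₂ _+_ leaves centres) ⟩
    (r + H) + (A + P)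
      ≡⟨ rearrange r H A P ⟩
    H + P + A + r ∎
    where
    open ≡-Reasoning
    rearrange : ∀ r H A P → (r + H) + (A + P) ≡ H + P + A + r
    rearrange = solve-∀

    hubs : ∑[ q < H ] degree (hub q) ≡ r + H
    hubs = begin
      ∑[ q < H ] degree (hub q)
        ≡⟨ ∑-distrib-+ {H} (λ q → ∑[ p < P ] ⟦ toℕ q * P + toℕ p <ᵇ r ⟧)
                           (λ q → ∑[ i < A ] ⟦ does (attach q ≟ i) ⟧) ⟩
      ∑[ q < H ] ∑[ p < P ] ⟦ toℕ q * P + toℕ p <ᵇ r ⟧ + ∑[ q < H ] ∑[ i < A ] ⟦ does (attach q ≟ i) ⟧
        ≡⟨ cong₂ _+_ (trans (∑-grid H P r) (m≤n⇒m⊓n≡m r≤HP))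
                     (trans (sum-cong-≗ {H} (λ q → ∑-singleton (attach q))) (∑-one H)) ⟩
      r + H ∎

    leaves : ∑[ i < A ] degree (leaf i) ≡ A
    leaves = trans (sum-cong-≗ {A} (λ i → cong₂ _+_ (∑-zero P) (∑-singleton i))) (∑-one A)

    centres : ∑[ j < B ] degree (centre j) ≡ P
    centres = begin
      ∑[ j < B ] degree (centre j)
        ≡⟨ sum-cong-≗ {B} (λ j → trans (cong (∑[ p < P ] ⟦ does (owner p ≟ j) ⟧ +_) (∑-zero A))
                                       (+-identityʳ _)) ⟩
      ∑[ j < B ] ∑[ p < P ] ⟦ does (owner p ≟ j) ⟧
        ≡⟨ ∑-comm (λ j p → ⟦ does (owner p ≟ j) ⟧) ⟩
      ∑[ p < P ] ∑[ j < B ] ⟦ does (owner p ≟ j) ⟧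
        ≡⟨ trans (sum-cong-≗ {P} (λ p → ∑-singleton (owner p))) (∑-one P) ⟩
      P ∎

  neighbour : ∀ y → ∃[ x ] biadj Link x y ≡ true
  neighbour (inj₁ (hub q))     = inj₂ (support (attach q)) , ≟-refl (attach q)
  neighbour (inj₁ (leaf i))    = inj₂ (support i) , ≟-refl i
  neighbour (inj₁ (centre j))  = inj₂ (spoke (twin₀ j)) , ≟-complete (owner-twin₀ j)
  neighbour (inj₂ (spoke p))   = inj₁ (centre (owner p)) , ≟-refl (owner p)
  neighbour (inj₂ (support i)) = inj₁ (leaf i) , ≟-refl i

  noIsolated : NoIsolated G
  noIsolated u with neighbour (vertex u)
  ... | x , x~u = index x , trans (adj-index x u) x~u

  inD₀ : Vertex → Bool
  inD₀ (inj₁ (hub _))     = false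
  inD₀ (inj₁ (leaf _))    = false
  inD₀ (inj₁ (centre _))  = true
  inD₀ (inj₂ (spoke _))   = false
  inD₀ (inj₂ (support _)) = true

  D₀ : Subset N
  D₀ = Vec.tabulate (inD₀ ∘ vertex)

  dominated-by-D₀ : ∀ y → inD₀ y ≡ true ⊎ ∃[ x ] (inD₀ x ≡ true × biadj Link x y ≡ true)
  dominated-by-D₀ (inj₁ (hub q))     = inj₂ (inj₂ (support (attach q)) , refl , ≟-refl (attach q))
  dominated-by-D₀ (inj₁ (leaf i))    = inj₂ (inj₂ (support i) , refl , ≟-refl i)
  dominated-by-D₀ (inj₁ (centre j))  = inj₁ refl
  dominated-by-D₀ (inj₂ (spoke p))   = inj₂ (inj₁ (centre (owner p)) , refl , ≟-refl (owner p))
  dominated-by-D₀ (inj₂ (support i)) = inj₁ refl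

  D₀-dominating : IsDominating G D₀
  D₀-dominating u u∉D₀ with dominated-by-D₀ (vertex u)
  ... | inj₁ u∈ = contradiction (∈-tabulate⁺ u∈) u∉D₀
  ... | inj₂ (x , x∈ , x~u) =
    index x , ∈-tabulate⁺ (trans (cong inD₀ (vertex-index x)) x∈) , trans (adj-index x u) x~u

  ∣D₀∣ : ∣ D₀ ∣ ≡ A + B
  ∣D₀∣ = begin
    ∣ D₀ ∣
      ≡⟨ ∣tabulate∣ (inD₀ ∘ vertex) ⟩
    ∑[ u < N ] ⟦ inD₀ (vertex u) ⟧
      ≡⟨ ∑-splitAt ℓ (λ x → ⟦ inD₀ (⊎-map left right x) ⟧) ⟩
    ∑[ l < ℓ ] ⟦ inD₀ (inj₁ (left l)) ⟧ + ∑[ x < ρ ] ⟦ inD₀ (inj₂ (right x)) ⟧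
      ≡⟨ cong₂ _+_ (∑-left (λ a → ⟦ inD₀ (inj₁ a) ⟧)) (∑-splitAt P (λ b → ⟦ inD₀ (inj₂ b) ⟧)) ⟩
    (∑[ q < H ] 0 + (∑[ i < A ] 0 + ∑[ j < B ] 1)) + (∑[ p < P ] 0 + ∑[ i < A ] 1)
      ≡⟨ cong₂ _+_ (cong₂ _+_ (∑-zero H) (cong₂ _+_ (∑-zero A) (∑-one B))) (cong₂ _+_ (∑-zero P) (∑-one A)) ⟩
    B + A
      ≡⟨ +-comm B A ⟩
    A + B ∎
    where open ≡-Reasoning

  Dom : Vertex → Vertex → Set
  Dom x y = x ≡ y ⊎ biadj Link x y ≡ true

  dominates⇒Dom : ∀ {u v} → Dominates G u v → Dom (vertex u) (vertex v)
  dominates⇒Dom         (inj₁ refl) = inj₁ refl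
  dominates⇒Dom {u} {v} (inj₂ u~v)  =
    inj₂ (trans (sym (biadj-map Link left right (splitAt ℓ u) (splitAt ℓ v))) u~v)

  Dom⇒dominates : ∀ {x y} → Dom x y → Dominates G (index x) (index y)
  Dom⇒dominates         (inj₁ refl) = inj₁ refl
  Dom⇒dominates {x} {y} (inj₂ x~y)  =
    inj₂ (trans (adj-index x (index y)) (subst (λ z → biadj Link x z ≡ true) (sym (vertex-index y)) x~y))

  packCentre : Fin (A + B) → Fin N
  packCentre c = index (inj₁ (inj₂ (splitAt A c)))

  -- Hubs dominate no packing centre.
  zone : Vertex → Fin A ⊎ Fin B
  zone (inj₁ (hub q))     = inj₁ (attach q)
  zone (inj₁ (leaf i))    = inj₁ i
  zone (inj₁ (centre j))  = inj₂ j
  zone (inj₂ (spoke p))   = inj₂ (owner p)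
  zone (inj₂ (support i)) = inj₁ i

  zone-of-dominator : ∀ x z → Dom x (inj₁ (inj₂ z)) → zone x ≡ z
  zone-of-dominator _                   (inj₁ i) (inj₁ refl) = refl
  zone-of-dominator _                   (inj₂ j) (inj₁ refl) = refl
  zone-of-dominator (inj₂ (spoke p))    (inj₂ j) (inj₂ e)    = cong inj₂ (≟-sound e)
  zone-of-dominator (inj₂ (support i′)) (inj₁ i) (inj₂ e)    = cong inj₁ (sym (≟-sound e))
  zone-of-dominator (inj₂ (spoke p))    (inj₁ i) (inj₂ ())
  zone-of-dominator (inj₂ (support i′)) (inj₂ j) (inj₂ ())
  zone-of-dominator (inj₁ _)            _        (inj₂ ())

  packing : IsPacking G packCentre
  packing {c} {c′} {u} d d′ = begin
    c                       ≡⟨ join-splitAt A B c ⟨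
    join A B (splitAt A c)  ≡⟨ cong (join A B) (trans (sym (zone-of d)) (zone-of d′)) ⟩
    join A B (splitAt A c′) ≡⟨ join-splitAt A B c′ ⟩
    c′                      ∎
    where
    open ≡-Reasoning
    zone-of : ∀ {c} → Dominates G u (packCentre c) → zone (vertex u) ≡ splitAt A c
    zone-of {c} d = zone-of-dominator (vertex u) (splitAt A c)
                                      (subst (Dom (vertex u)) (vertex-index _) (dominates⇒Dom d))

  module Unique {D : Subset N} (dom : IsDominating G D) (∣D∣≤A+B : ∣ D ∣ ≤ A + B) where
    open Packing {G = G} {w = packCentre} packing {D = D} dom
    open Tight ∣D∣≤A+B

    In : Vertex → Set
    In x = index x ∈ D

    dominatorIn : ∀ y → ∃[ x ] (In x × Dom x y)
    dominatorIn y with dominator {G = G} dom (index y)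
    ... | u , u∈D , u↝y = vertex u , subst (_∈ D) (sym (index-vertex u)) u∈D ,
                          subst (Dom (vertex u)) (vertex-index y) (dominates⇒Dom u↝y)

    unique-dominator : ∀ x y z → In x → In y → Dom x (inj₁ (inj₂ z)) → Dom y (inj₁ (inj₂ z)) → x ≡ y
    unique-dominator x y z x∈D y∈D x↝z y↝z =
      index-injective (unique x∈D y∈D (toPackCentre x↝z) (toPackCentre y↝z))
      where
      toPackCentre : ∀ {x} → Dom x (inj₁ (inj₂ z)) → Dominates G (index x) (packCentre (join A B z))
      toPackCentre {x} d = subst (λ t → Dominates G (index x) (index (inj₁ (inj₂ t))))
                                 (sym (splitAt-join A B z)) (Dom⇒dominates d)

    hub∉D : ∀ q → ¬ In (inj₁ (hub q))
    hub∉D q h∈D with covered h∈D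
    ... | c , d with subst₂ Dom (vertex-index (inj₁ (hub q))) (vertex-index (inj₁ (inj₂ (splitAt A c))))
                           (dominates⇒Dom d)
    ...   | inj₁ ()
    ...   | inj₂ ()

    spoke∉D : ∀ p → ¬ In (inj₂ (spoke p))
    spoke∉D p p∈D with sibling p
    ... | s , s≢p , same-owner with dominatorIn (inj₂ (spoke s))
    ...   | _ , s∈D , inj₁ refl
            with unique-dominator (inj₂ (spoke s)) (inj₂ (spoke p)) (inj₂ (owner p)) s∈D p∈D
                                  (inj₂ (≟-complete same-owner)) (inj₂ (≟-refl (owner p)))
    ...     | refl = s≢p refl
    spoke∉D p p∈D | s , s≢p , same-owner | inj₁ (centre j) , c∈D , inj₂ e
            with unique-dominator (inj₁ (centre j)) (inj₂ (spoke p)) (inj₂ (owner p)) c∈D p∈D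
                                  (inj₁ (cong (inj₁ ∘ centre) (trans (sym (≟-sound e)) same-owner)))
                                  (inj₂ (≟-refl (owner p)))
    ...     | ()
    spoke∉D p p∈D | _ | inj₁ (hub q)  , h∈D , inj₂ _ = hub∉D q h∈D
    spoke∉D p p∈D | _ | inj₁ (leaf _) , _   , inj₂ ()
    spoke∉D p p∈D | _ | inj₂ _        , _   , inj₂ ()

    leaf∉D : ∀ i → ¬ In (inj₁ (leaf i))
    leaf∉D i l∈D with dominatorIn (inj₁ (hub (guard i)))
    ... | _ , h∈D , inj₁ refl = hub∉D (guard i) h∈D
    ... | inj₂ (support i′) , s∈D , inj₂ e
          with unique-dominator (inj₂ (support i′)) (inj₁ (leaf i)) (inj₁ i) s∈D l∈D
                                (inj₂ (≟-complete (trans (sym (attach-guard i)) (≟-sound e)))) (inj₁ refl)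
    ...   | ()
    leaf∉D i l∈D | inj₂ (spoke p) , p∈D , inj₂ _ = spoke∉D p p∈D
    leaf∉D i l∈D | inj₁ _         , _   , inj₂ ()

    centre∈D : ∀ j → In (inj₁ (centre j))
    centre∈D j with dominatorIn (inj₁ (centre j))
    ... | _                , x∈D , inj₁ refl = x∈D
    ... | inj₂ (spoke p)   , p∈D , inj₂ _    = contradiction p∈D (spoke∉D p)
    ... | inj₂ (support _) , _   , inj₂ ()
    ... | inj₁ _           , _   , inj₂ ()

    support∈D : ∀ i → In (inj₂ (support i))
    support∈D i with dominatorIn (inj₁ (leaf i))
    ... | _                 , x∈D , inj₁ refl = contradiction x∈D (leaf∉D i)
    ... | inj₂ (support i′) , x∈D , inj₂ e    = subst (λ k → In (inj₂ (support k))) (sym (≟-sound e)) x∈D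
    ... | inj₂ (spoke _)    , _   , inj₂ ()
    ... | inj₁ _            , _   , inj₂ ()

    In⇒inD₀ : ∀ x → In x → inD₀ x ≡ true
    In⇒inD₀ (inj₁ (hub q))     x∈D = contradiction x∈D (hub∉D q)
    In⇒inD₀ (inj₁ (leaf i))    x∈D = contradiction x∈D (leaf∉D i)
    In⇒inD₀ (inj₁ (centre j))  _   = refl
    In⇒inD₀ (inj₂ (spoke p))   x∈D = contradiction x∈D (spoke∉D p)
    In⇒inD₀ (inj₂ (support i)) _   = refl

    inD₀⇒In : ∀ x → inD₀ x ≡ true → In x
    inD₀⇒In (inj₁ (centre j))  _ = centre∈D j
    inD₀⇒In (inj₂ (support i)) _ = support∈D i

    D≡D₀ : D ≡ D₀
    D≡D₀ = ⊆-antisym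
      (λ {u} u∈D → ∈-tabulate⁺ (In⇒inD₀ (vertex u) (subst (_∈ D) (sym (index-vertex u)) u∈D)))
      (λ {u} u∈D₀ → subst (_∈ D) (index-vertex u) (inD₀⇒In (vertex u) (∈-tabulate⁻ u∈D₀)))

realise : ∀ A B H P s .{{_ : NonZero A}} .{{_ : NonZero B}} → A ≤ H → 2 * B ≤ P →
          H + P + A ≤ s → s ≤ H + P + A + H * P →
          Σ (Graph (H + (A + B) + (P + A))) (λ G → InB _ (A + B) G × size G ≡ s)
realise A B H P s A≤H 2B≤P base≤s s≤top =
  G ,
  ( bipartiteGraph-isBipartite (λ l x → Link (left l) (right x))
  , noIsolated
  , uniqueMinimum {G = G} D₀-dominating ∣D₀∣
                  (λ D dom → Packing.≤∣D∣ {G = G} {w = packCentre} packing {D = D} dom)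
                  (λ D dom tight → Unique.D≡D₀ {D = D} dom tight)) ,
  trans (size-G (m≤n+o⇒m∸n≤o s (H + P + A) s≤top)) (m+[n∸m]≡n base≤s)
  where open Construction A B H P (s ∸ (H + P + A)) A≤H 2B≤P
-- Locating m(n, γ)

sumFrom1-mono : ∀ (f : ℕ → ℕ) {x y} → x ≤ y → sumFrom1 x f ≤ sumFrom1 y f
sumFrom1-mono f {y = zero}  z≤n = ≤-refl
sumFrom1-mono f {y = suc y} x≤1+y with m≤n⇒m<n∨m≡n x≤1+y
... | inj₁ (s≤s x≤y) = ≤-trans (sumFrom1-mono f x≤y) (m≤m+n (sumFrom1 y f) (f (suc y)))
... | inj₂ refl      = ≤-refl

sumFrom1-≥ : ∀ (f : ℕ → ℕ) → (∀ i → 1 ≤ f i) → ∀ x → x ≤ sumFrom1 x f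
sumFrom1-≥ f 1≤f zero    = z≤n
sumFrom1-≥ f 1≤f (suc x) =
  subst (_≤ sumFrom1 x f + f (suc x)) (+-comm x 1) (+-mono-≤ (sumFrom1-≥ f 1≤f x) (1≤f (suc x)))

sumFrom1-ceil : ∀ x j → sumFrom1 j (λ i → (x + 1) + ⌈ i /2⌉) + (x + 1) * x
                        ≡ j + (x + 1 + ⌊ j /2⌋) * (x + ⌈ j /2⌉)
sumFrom1-ceil x zero          = base x
  where
  base : ∀ x → 0 + (x + 1) * x ≡ 0 + (x + 1 + 0) * (x + 0)
  base = solve-∀
sumFrom1-ceil x (suc zero)    = base x
  where
  base : ∀ x → 0 + (x + 1 + 1) + (x + 1) * x ≡ 1 + (x + 1 + 0) * (x + 1)
  base = solve-∀
sumFrom1-ceil x (suc (suc j)) = begin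
  sumFrom1 j f + f (suc j) + f (suc (suc j)) + (x + 1) * x
    ≡⟨ shuffle (sumFrom1 j f) (f (suc j)) (f (suc (suc j))) ((x + 1) * x) ⟩
  (sumFrom1 j f + (x + 1) * x) + (f (suc j) + f (suc (suc j)))
    ≡⟨ cong (_+ (f (suc j) + f (suc (suc j)))) (sumFrom1-ceil x j) ⟩
  j + (x + 1 + ⌊ j /2⌋) * (x + ⌈ j /2⌉) + ((x + 1) + suc ⌊ j /2⌋ + ((x + 1) + suc ⌈ j /2⌉))
    ≡⟨ step x j ⌊ j /2⌋ ⌈ j /2⌉ ⟩
  suc (suc j) + (x + 1 + suc ⌊ j /2⌋) * (x + suc ⌈ j /2⌉) ∎
  where
  open ≡-Reasoning
  f : ℕ → ℕ
  f i = (x + 1) + ⌈ i /2⌉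
  shuffle : ∀ s p q e → s + p + q + e ≡ (s + e) + (p + q)
  shuffle = solve-∀
  step : ∀ x j u v → j + (x + 1 + u) * (x + v) + ((x + 1) + suc u + ((x + 1) + suc v))
                   ≡ suc (suc j) + (x + 1 + suc u) * (x + suc v)
  step = solve-∀

2a+b≤1+2ab : ∀ a b → 1 ≤ a → 1 ≤ b → 2 * a + b ≤ suc (2 * a * b)
2a+b≤1+2ab (suc a′) (suc b′) _ _ =
  ≤-trans (m≤m+n (2 * suc a′ + suc b′) (2 * a′ * b′ + b′)) (≤-reflexive (expand a′ b′))
  where
  expand : ∀ a′ b′ → 2 * suc a′ + suc b′ + (2 * a′ * b′ + b′) ≡ suc (2 * suc a′ * suc b′)
  expand = solve-∀

-- The left side is m(n, γ) − 2γ with Φ replaced by j; the right side is the size of the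
-- construction with a complete hub–spoke grid, minus 2γ.
edges-identity : ∀ a b w j → j ≡ 0 ⊎ b + w ≡ 2 * a + 1 →
                 2 * a * b + w * (2 * a + 1) + sumFrom1 j (λ i → (2 * a + 1) + ⌈ i /2⌉)
                 ≡ w + j + (b + w + ⌊ j /2⌋) * (2 * a + ⌈ j /2⌉)
edges-identity a b w .0 (inj₁ refl) = complete a b w
  where
  complete : ∀ a b w → 2 * a * b + w * (2 * a + 1) + 0 ≡ w + 0 + (b + w + 0) * (2 * a + 0)
  complete = solve-∀
edges-identity a b w j (inj₂ b+w≡c) = begin
  2 * a * b + w * c + S
    ≡⟨ regroup a b w S ⟩
  w + (S + 2 * a * (b + w))
    ≡⟨ cong (λ z → w + (S + 2 * a * z)) b+w≡c ⟩
  w + (S + 2 * a * c)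
    ≡⟨ cong (λ z → w + (S + z)) (*-comm (2 * a) c) ⟩
  w + (S + c * (2 * a))
    ≡⟨ cong (w +_) (sumFrom1-ceil (2 * a) j) ⟩
  w + (j + (c + ⌊ j /2⌋) * (2 * a + ⌈ j /2⌉))
    ≡⟨ cong (λ z → w + (j + (z + ⌊ j /2⌋) * (2 * a + ⌈ j /2⌉))) (sym b+w≡c) ⟩
  w + (j + (b + w + ⌊ j /2⌋) * (2 * a + ⌈ j /2⌉))
    ≡⟨ +-assoc w j _ ⟨
  w + j + (b + w + ⌊ j /2⌋) * (2 * a + ⌈ j /2⌉) ∎
  where
  open ≡-Reasoning
  c = 2 * a + 1
  S = sumFrom1 j (λ i → c + ⌈ i /2⌉)
  regroup : ∀ a b w S → 2 * a * b + w * (2 * a + 1) + S ≡ w + (S + 2 * a * (b + w))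
  regroup = solve-∀

-- Of the k = n − 3γ vertices beyond three per dominating vertex, up to t become hubs and the
-- remaining j are shared evenly between hubs and spokes.
module Parameters (γ n : ℕ) (2≤γ : 2 ≤ γ) (3γ≤n : 3 * γ ≤ n) where

  a b c k t w j H P : ℕ
  a = ⌈ γ /2⌉
  b = ⌊ γ /2⌋
  c = 2 * a + 1
  k = n ∸ 3 * γ
  t = c ∸ b
  w = k ⊓ t
  j = k ∸ t
  H = b + w + ⌊ j /2⌋
  P = 2 * a + ⌈ j /2⌉

  S : ℕ → ℕ
  S x = sumFrom1 x (λ i → c + ⌈ i /2⌉)

  1≤b : 1 ≤ b
  1≤b = ⌊n/2⌋-mono 2≤γ

  1≤a : 1 ≤ a
  1≤a = ≤-trans 1≤b (⌊n/2⌋≤⌈n/2⌉ γ)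

  instance
    b-nonZero : NonZero b
    b-nonZero = >-nonZero 1≤b

    a-nonZero : NonZero a
    a-nonZero = >-nonZero 1≤a

  b≤H : b ≤ H
  b≤H = ≤-trans (m≤m+n b w) (m≤m+n (b + w) ⌊ j /2⌋)

  2a≤P : 2 * a ≤ P
  2a≤P = m≤m+n (2 * a) ⌈ j /2⌉

  b+a≡γ : b + a ≡ γ
  b+a≡γ = ⌊n/2⌋+⌈n/2⌉≡n γ

  b+t≡c : b + t ≡ c
  b+t≡c = m+[n∸m]≡n (≤-trans (⌊n/2⌋≤⌈n/2⌉ γ) (≤-trans (m≤m+n a (a + 0)) (m≤m+n (2 * a) 1)))

  w+j≡k : w + j ≡ k
  w+j≡k = trans (cong (_+ j) (⊓-comm k t)) (m⊓n+n∸m≡n t k)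

  3γ+k≡n : 3 * γ + k ≡ n
  3γ+k≡n = m+[n∸m]≡n 3γ≤n

  base≡ : H + P + b ≡ 2 * γ + k
  base≡ = begin
    b + w + ⌊ j /2⌋ + (2 * a + ⌈ j /2⌉) + b ≡⟨ regroup b a w ⌊ j /2⌋ ⌈ j /2⌉ ⟩
    2 * (b + a) + (w + (⌊ j /2⌋ + ⌈ j /2⌉)) ≡⟨ cong₂ (λ x y → 2 * x + (w + y)) b+a≡γ (⌊n/2⌋+⌈n/2⌉≡n j) ⟩
    2 * γ + (w + j)                         ≡⟨ cong (2 * γ +_) w+j≡k ⟩
    2 * γ + k ∎
    where
    open ≡-Reasoning
    regroup : ∀ b a w u v → b + w + u + (2 * a + v) + b ≡ 2 * (b + a) + (w + (u + v))
    regroup = solve-∀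

  order : H + (b + a) + (P + b) ≡ n
  order = begin
    H + (b + a) + (P + b) ≡⟨ regroup H P b a ⟩
    H + P + b + (b + a)   ≡⟨ cong₂ _+_ base≡ b+a≡γ ⟩
    2 * γ + k + γ         ≡⟨ regroup′ γ k ⟩
    3 * γ + k             ≡⟨ 3γ+k≡n ⟩
    n ∎
    where
    open ≡-Reasoning
    regroup : ∀ H P b a → H + (b + a) + (P + b) ≡ H + P + b + (b + a)
    regroup = solve-∀
    regroup′ : ∀ γ k → 2 * γ + k + γ ≡ 3 * γ + k
    regroup′ = solve-∀

  Φ≡ : Φ n γ ≡ suc k ∸ (2 * a + b)
  Φ≡ = begin
    (n + 1) ∸ (3 * γ + 2 * a + b)           ≡⟨ cong₂ _∸_ n+1≡ (+-assoc (3 * γ) (2 * a) b) ⟩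
    (3 * γ + suc k) ∸ (3 * γ + (2 * a + b)) ≡⟨ [m+n]∸[m+o]≡n∸o (3 * γ) (suc k) (2 * a + b) ⟩
    suc k ∸ (2 * a + b) ∎
    where
    open ≡-Reasoning
    n+1≡ : n + 1 ≡ 3 * γ + suc k
    n+1≡ = trans (cong (_+ 1) (sym 3γ+k≡n)) (trans (+-assoc (3 * γ) k 1) (cong (3 * γ +_) (+-comm k 1)))

  Φ≤j : Φ n γ ≤ j
  Φ≤j = subst (_≤ j) (sym Φ≡) (∸-monoʳ-≤ (suc k) 1+t≤2a+b)
    where
    1+t≤2a+b : suc t ≤ 2 * a + b
    1+t≤2a+b = begin
      suc t     ≡⟨ +-comm 1 t ⟩
      t + 1     ≤⟨ +-monoʳ-≤ t 1≤b ⟩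
      t + b     ≡⟨ trans (+-comm t b) b+t≡c ⟩
      2 * a + 1 ≤⟨ +-monoʳ-≤ (2 * a) 1≤b ⟩
      2 * a + b ∎
      where open ≤-Reasoning

  m≡ : m n γ ≡ 2 * γ + (2 * a * b + w * c + S (Φ n γ))
  m≡ = regroup (2 * γ) (2 * a * b) (w * c) (S (Φ n γ))
    where
    regroup : ∀ x y z u → x + y + z + u ≡ x + (y + z + u)
    regroup = solve-∀

  lower : H + P + b ≤ m n γ
  lower = begin
    H + P + b                                  ≡⟨ base≡ ⟩
    2 * γ + k                                  ≤⟨ +-monoʳ-≤ (2 * γ) k≤ ⟩
    2 * γ + (2 * a * b + w * c + S (Φ n γ))    ≡⟨ m≡ ⟨
    m n γ ∎
    where
    open ≤-Reasoning
    Φ≤SΦ : Φ n γ ≤ S (Φ n γ)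
    Φ≤SΦ = sumFrom1-≥ (λ i → c + ⌈ i /2⌉) (λ i → ≤-trans (m≤n+m 1 (2 * a)) (m≤m+n c ⌈ i /2⌉)) (Φ n γ)
    1+k≤ : suc k ≤ suc (2 * a * b + S (Φ n γ))
    1+k≤ = begin
      suc k                             ≤⟨ m≤n+m∸n (suc k) (2 * a + b) ⟩
      2 * a + b + (suc k ∸ (2 * a + b)) ≡⟨ cong (2 * a + b +_) Φ≡ ⟨
      2 * a + b + Φ n γ                 ≤⟨ +-mono-≤ (2a+b≤1+2ab a b 1≤a 1≤b) Φ≤SΦ ⟩
      suc (2 * a * b + S (Φ n γ)) ∎
    k≤ : k ≤ 2 * a * b + w * c + S (Φ n γ)
    k≤ = ≤-trans (s≤s⁻¹ 1+k≤) (+-monoˡ-≤ (S (Φ n γ)) (m≤m+n (2 * a * b) (w * c)))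

  upper : m n γ ≤ H + P + b + H * P
  upper = begin
    m n γ                                  ≡⟨ m≡ ⟩
    2 * γ + (2 * a * b + w * c + S (Φ n γ)) ≤⟨ +-monoʳ-≤ (2 * γ) (+-monoʳ-≤ (2 * a * b + w * c) SΦ≤Sj) ⟩
    2 * γ + (2 * a * b + w * c + S j)       ≡⟨ cong (2 * γ +_) (edges-identity a b w j j≡0⊎b+w≡c) ⟩
    2 * γ + (w + j + H * P)                 ≡⟨ cong (λ z → 2 * γ + (z + H * P)) w+j≡k ⟩
    2 * γ + (k + H * P)                     ≡⟨ +-assoc (2 * γ) k (H * P) ⟨
    2 * γ + k + H * P                       ≡⟨ cong (_+ H * P) base≡ ⟨
    H + P + b + H * P ∎
    where
    open ≤-Reasoning
    SΦ≤Sj : S (Φ n γ) ≤ S j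
    SΦ≤Sj = sumFrom1-mono (λ i → c + ⌈ i /2⌉) Φ≤j
    j≡0⊎b+w≡c : j ≡ 0 ⊎ b + w ≡ c
    j≡0⊎b+w≡c with ≤-total k t
    ... | inj₁ k≤t = inj₁ (m≤n⇒m∸n≡0 k≤t)
    ... | inj₂ t≤k = inj₂ (trans (cong (b +_) (m≥n⇒m⊓n≡n t≤k)) b+t≡c)

theorem2p3 : (γ n : ℕ) → 2 ≤ γ → 3 * γ ≤ n →
    Σ (Graph n) (λ G → InB n γ G × size G ≡ m n γ)
theorem2p3 γ n 2≤γ 3γ≤n =
  subst₂ (λ N γ′ → Σ (Graph N) (λ G → InB N γ′ G × size G ≡ m n γ)) order b+a≡γ
    (realise b a H P (m n γ) b≤H 2a≤P lower upper)
  where open Parameters γ n 2≤γ 3γ≤n
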